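{- Let $t,\ell,\lambda,m$ be integers with $t>\ell\ge0$, $\lambda\ge1$ and $m>t+\ell+\lambda+2$. Let $A$ be an $m$-rowed $(0,1)$-matrix with $(\lambda+2)\cdot{\bf 1}_t{\bf 0}_\ell\not\prec A$, all column sums in $\{t,\dots,m-\ell\}$ and no repeated column of sum $t$. Let $A_{t+1}$ be the submatrix of columns of $A$ of column sum $t+1$, and for a row $r\in[m]$ let $A^r_{t+1}$ be the submatrix of $A_{t+1}$ formed by the columns having a $1$ in row $r$. Then $$\|A^r_{t+1}\|\le\frac{\lambda+1}{t}\binom{m-1}{t-1}.$$
   Context: $\|\cdot\|$ denotes number of columns counted with multiplicity. ${\bf 1}_t{\bf 0}_\ell$ is the column of $t$ ones above $\ell$ zeros, $q\cdot{\bf v}$ is $q$ copies of ${\bf v}$, and $F\prec A$ means some submatrix of $A$ is a row and column permutation of $F$. -}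

module Defs where

open import Data.Nat using (ℕ; zero; suc; _+_; _<ᵇ_)
open import Data.Bool using (Bool; true; false; if_then_else_)
open import Data.Fin using (Fin; zero; suc; toℕ)
open import Data.Product using (Σ; _×_; _,_)
open import Function.Definitions using (Injective)
open import Relation.Binary.PropositionalEquality using (_≡_)

-- A (0,1)-matrix with m rows and n columns; entry (i , j) is  M i j.
-- Columns are indexed by Fin n, so repeated columns are counted with multiplicity.
Matrix : ℕ → ℕ → Set
Matrix m n = Fin m → Fin n → Bool

count : {n : ℕ} → (Fin n → Bool) → ℕ
count {zero}  p = 0
count {suc n} p = (if p zero then 1 else 0) + count (λ i → p (suc i))

colSum : {m n : ℕ} → Matrix m n → Fin n → ℕ
colSum A j = count (λ i → A i j)

-- F ≺ A : some submatrix of A is a row and column permutation of F,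
-- i.e. there are injective row and column selections realising F.
_≺_ : {k p m n : ℕ} → Matrix k p → Matrix m n → Set
_≺_ {k} {p} {m} {n} F A =
  Σ (Fin k → Fin m) λ σ → Σ (Fin p → Fin n) λ τ →
    Injective _≡_ _≡_ σ × Injective _≡_ _≡_ τ ×
    (∀ i j → A (σ i) (τ j) ≡ F i j)

copiesOneZero : (q t ℓ : ℕ) → Matrix (t + ℓ) q
copiesOneZero q t ℓ i j = toℕ i <ᵇ t

_≡ᵇ_ : ℕ → ℕ → Bool
zero ≡ᵇ zero = true
zero ≡ᵇ suc b = false
suc a ≡ᵇ zero = false
suc a ≡ᵇ suc b = a ≡ᵇ b

colsWithSumAndRow : {m n : ℕ} → Matrix m n → ℕ → Fin m → ℕ
colsWithSumAndRow A s r = count (λ j → if colSum A j ≡ᵇ s then A r j else false)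

-- Double counting. Deleting row r, each column of sum t+1 through r becomes a t-set of the
-- remaining m-1 rows and so contains t of their (t-1)-subsets; hence t·‖A^r_{t+1}‖ counts pairs
-- (column, (t-1)-set T). Each T lies in at most λ+1 of these columns: otherwise λ+2 columns of sum
-- t+1 share the t-set T ∪ {r}, their union has at most t+λ+2 rows, and since m ≥ t+ℓ+λ+2 some ℓ
-- further rows are zero in all of them, which exhibits (λ+2)·1_t0_ℓ ≺ A. Summing over the
-- binom(m-1,t-1) sets T gives the bound.
module Submission where

open import Defs
open import Data.Bool using (Bool; true; false; _∧_; _∨_; not; if_then_else_)
open import Data.Bool.Properties
  using (∧-assoc; ∨-assoc; ∧-comm; ∧-identityʳ; ∨-identityʳ; not-injective; if-eta)
open import Data.Empty using (⊥-elim)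
open import Data.Fin using (Fin; zero; suc; splitAt; join; _↑ˡ_; _↑ʳ_; punchIn)
import Data.Fin.Properties as Fin
open import Data.Nat using (ℕ; zero; suc; _+_; _*_; _∸_; _≤_; _<_; z≤n; s≤s; _≤?_; s≤s⁻¹)
open import Data.Nat.Combinatorics using (_C_; nCk+nC[k+1]≡[n+1]C[k+1]; nCk≡nC[n∸k]; nC1≡n)
open import Data.Nat.Properties
  using ( +-0-commutativeMonoid; +-suc; +-comm; +-assoc; +-identityʳ; *-identityʳ; *-distribˡ-+
        ; +-mono-≤; +-monoˡ-≤; +-cancelʳ-≤; +-cancelˡ-≡; ≤-refl; ≤-reflexive; ≤-trans; m≤n⇒m≤1+n
        ; ≰⇒>; <⇒≤; n≤1+n; m+n∸n≡m; suc-injective; module ≤-Reasoning)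
open import Algebra.Properties.CommutativeMonoid.Sum +-0-commutativeMonoid
  using (sum-syntax; ∑-distrib-+; sum-cong-≗; sum-replicate-zero)
open import Data.Product using (Σ; _×_; _,_; proj₁; proj₂)
open import Data.Sum using (inj₁; inj₂; [_,_]′)
open import Data.Vec.Functional using (_∷_; insertAt)
open import Data.Vec.Functional.Properties using (insertAt-lookup; insertAt-punchIn)
open import Function using (_∘_)
open import Function.Definitions using (Injective)
open import Relation.Binary.PropositionalEquality
open import Relation.Nullary using (¬_; yes; no)

_⊆_ : {n : ℕ} → (Fin n → Bool) → (Fin n → Bool) → Set
p ⊆ q = ∀ i → p i ≡ true → q i ≡ true

_∪_ _─_ : {n : ℕ} → (Fin n → Bool) → (Fin n → Bool) → Fin n → Bool
(p ∪ q) i = p i ∨ q i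
(p ─ q) i = p i ∧ not (q i)

⋃ : {q n : ℕ} → (Fin q → Fin n → Bool) → Fin n → Bool
⋃ {zero}  P i = false
⋃ {suc q} P   = ⋃ (P ∘ suc) ∪ P zero

_⊆ᵇ_ : {n : ℕ} → (Fin n → Bool) → (Fin n → Bool) → Bool
_⊆ᵇ_ {zero}  p q = true
_⊆ᵇ_ {suc n} p q = (not (p zero) ∨ q zero) ∧ ((p ∘ suc) ⊆ᵇ (q ∘ suc))

∨-false : ∀ {x y} → x ∨ y ≡ false → x ≡ false × y ≡ false
∨-false {false} {false} _ = refl , refl

∧-true : ∀ {x y} → x ∧ y ≡ true → x ≡ true × y ≡ true
∧-true {true} {true} _ = refl , refl

⊆ᵇ⇒⊆ : {n : ℕ} {p q : Fin n → Bool} → (p ⊆ᵇ q) ≡ true → p ⊆ q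
⊆ᵇ⇒⊆ {suc n} {p} {q} h zero pi with p zero | q zero
... | true  | true  = refl
⊆ᵇ⇒⊆ {suc n} {p} {q} () zero pi | true | false
⊆ᵇ⇒⊆ {suc n} {p} {q} h zero () | false | _
⊆ᵇ⇒⊆ {suc n} {p} {q} h (suc i) pi = ⊆ᵇ⇒⊆ (proj₂ (∧-true {not (p zero) ∨ q zero} h)) i pi

∅⊆ᵇ : {n : ℕ} (q : Fin n → Bool) → ((λ _ → false) ⊆ᵇ q) ≡ true
∅⊆ᵇ {zero}  q = refl
∅⊆ᵇ {suc n} q = ∅⊆ᵇ (q ∘ suc)

count-cong : {n : ℕ} {p q : Fin n → Bool} → p ≗ q → count p ≡ count q
count-cong {zero}  eq = refl
count-cong {suc n} eq = cong₂ _+_ (cong (λ b → if b then 1 else 0) (eq zero)) (count-cong (eq ∘ suc))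

count-∅ : (n : ℕ) → count {n} (λ _ → false) ≡ 0
count-∅ zero    = refl
count-∅ (suc n) = count-∅ n

count-mono : {n : ℕ} {p q : Fin n → Bool} → p ⊆ q → count p ≤ count q
count-mono {zero}          p⊆q = z≤n
count-mono {suc n} {p} {q} p⊆q with p zero | q zero | p⊆q zero
... | true  | true  | _  = s≤s (count-mono (p⊆q ∘ suc))
... | true  | false | h  with () ← h refl
... | false | true  | _  = m≤n⇒m≤1+n (count-mono (p⊆q ∘ suc))
... | false | false | _  = count-mono (p⊆q ∘ suc)

count-∪ : {n : ℕ} (p q : Fin n → Bool) → count (p ∪ q) ≡ count p + count (q ─ p)
count-∪ {zero}  p q = refl
count-∪ {suc n} p q with p zero | q zero
... | true  | true  = cong suc (count-∪ (p ∘ suc) (q ∘ suc))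
... | true  | false = cong suc (count-∪ (p ∘ suc) (q ∘ suc))
... | false | true  = trans (cong suc (count-∪ (p ∘ suc) (q ∘ suc))) (sym (+-suc _ _))
... | false | false = count-∪ (p ∘ suc) (q ∘ suc)

count-─ : {n : ℕ} {p q : Fin n → Bool} → p ⊆ q → count p + count (q ─ p) ≡ count q
count-─ {zero}          p⊆q = refl
count-─ {suc n} {p} {q} p⊆q with p zero | q zero | p⊆q zero
... | true  | true  | _ = cong suc (count-─ (p⊆q ∘ suc))
... | true  | false | h with () ← h refl
... | false | true  | _ = trans (+-suc _ _) (cong suc (count-─ (p⊆q ∘ suc)))
... | false | false | _ = count-─ (p⊆q ∘ suc)

count-∁ : {n : ℕ} (p : Fin n → Bool) → count p + count (not ∘ p) ≡ n
count-∁ {zero}  p = refl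
count-∁ {suc n} p with p zero
... | true  = cong suc (count-∁ (p ∘ suc))
... | false = trans (+-suc _ _) (cong suc (count-∁ (p ∘ suc)))

count-punchIn : {n : ℕ} (p : Fin (suc n) → Bool) (r : Fin (suc n)) →
  p r ≡ true → count p ≡ suc (count (p ∘ punchIn r))
count-punchIn p zero pr rewrite pr = refl
count-punchIn {suc n} p (suc r) pr =
  trans (cong ((if p zero then 1 else 0) +_) (count-punchIn (p ∘ suc) r pr)) (+-suc _ _)

∑-if : {n : ℕ} (p : Fin n → Bool) (c : ℕ) → ∑[ j < n ] (if p j then c else 0) ≡ count p * c
∑-if {zero}  p c = refl
∑-if {suc n} p c with p zero
... | true  = cong (c +_) (∑-if (p ∘ suc) c)
... | false = ∑-if (p ∘ suc) c

select : {n : ℕ} (p : Fin n → Bool) (q : ℕ) → q ≤ count p →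
  Σ (Fin q → Fin n) λ τ → Injective _≡_ _≡_ τ × (∀ j → p (τ j) ≡ true)
select p zero _ = (λ ()) , (λ { {()} }) , (λ ())
select {suc n} p (suc q) h with p zero in e
... | true with select (p ∘ suc) q (s≤s⁻¹ h)
...   | τ , τ-inj , pτ = τ′ , τ′-inj , pτ′
  where
  τ′ : Fin (suc q) → Fin (suc n)
  τ′ zero    = zero
  τ′ (suc j) = suc (τ j)
  τ′-inj : Injective _≡_ _≡_ τ′
  τ′-inj {zero}  {zero}  _  = refl
  τ′-inj {suc x} {suc y} eq = cong suc (τ-inj (Fin.suc-injective eq))
  pτ′ : ∀ j → p (τ′ j) ≡ true
  pτ′ zero    = e
  pτ′ (suc j) = pτ j
select {suc n} p (suc q) h | false with select (p ∘ suc) (suc q) h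
... | τ , τ-inj , pτ = suc ∘ τ , τ-inj ∘ Fin.suc-injective , pτ

⋃-false : {q n : ℕ} (P : Fin q → Fin n → Bool) {i : Fin n} → ⋃ P i ≡ false → ∀ j → P j i ≡ false
⋃-false {suc q} P h zero    = proj₂ (∨-false h)
⋃-false {suc q} P h (suc j) = ⋃-false (P ∘ suc) (proj₁ (∨-false h)) j

count-∪⋃≤ : {q n : ℕ} (U : Fin n → Bool) (P : Fin q → Fin n → Bool) →
  (∀ j → U ⊆ P j) → (∀ j → count (P j) ≡ suc (count U)) → count (U ∪ ⋃ P) ≤ count U + q
count-∪⋃≤ {zero}  U P _ _ =
  ≤-reflexive (trans (count-cong (∨-identityʳ ∘ U)) (sym (+-identityʳ _)))
count-∪⋃≤ {suc q} {n} U P U⊆P ∣P∣ = begin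
  count (U ∪ ⋃ P)                   ≡⟨ count-cong (λ i → sym (∨-assoc (U i) _ _)) ⟩
  count (X ∪ P zero)                ≡⟨ count-∪ X (P zero) ⟩
  count X + count (P zero ─ X)      ≤⟨ +-mono-≤ (count-∪⋃≤ U (P ∘ suc) (U⊆P ∘ suc) (∣P∣ ∘ suc))
                                                 (count-mono P₀─X⊆P₀─U) ⟩
  count U + q + count (P zero ─ U)  ≡⟨ cong (count U + q +_) ∣P₀─U∣≡1 ⟩
  count U + q + 1                   ≡⟨ trans (+-assoc (count U) q 1) (cong (count U +_) (+-comm q 1)) ⟩
  count U + suc q                   ∎
  where
  open ≤-Reasoning
  X : Fin n → Bool
  X = U ∪ ⋃ (P ∘ suc)
  P₀─X⊆P₀─U : (P zero ─ X) ⊆ (P zero ─ U)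
  P₀─X⊆P₀─U i h with P zero i | U i
  ... | true  | false = refl
  P₀─X⊆P₀─U i () | true | true
  P₀─X⊆P₀─U i () | false | _
  ∣P₀─U∣≡1 : count (P zero ─ U) ≡ 1
  ∣P₀─U∣≡1 = +-cancelˡ-≡ (count U) _ 1
    (trans (count-─ (U⊆P zero)) (trans (∣P∣ zero) (+-comm 1 (count U))))

splitAt-injective : (a : ℕ) {b : ℕ} → Injective _≡_ _≡_ (splitAt a {b})
splitAt-injective a {b} {x} {y} eq =
  trans (sym (Fin.join-splitAt a b x)) (trans (cong (join a b) eq) (Fin.join-splitAt a b y))

[,]′-injective : {A B C : Set} {f : A → C} {g : B → C} →
  Injective _≡_ _≡_ f → Injective _≡_ _≡_ g → (∀ a b → f a ≢ g b) → Injective _≡_ _≡_ [ f , g ]′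
[,]′-injective f-inj g-inj f≢g {inj₁ a} {inj₁ a′} eq = cong inj₁ (f-inj eq)
[,]′-injective f-inj g-inj f≢g {inj₁ a} {inj₂ b}  eq = ⊥-elim (f≢g a b eq)
[,]′-injective f-inj g-inj f≢g {inj₂ b} {inj₁ a}  eq = ⊥-elim (f≢g a b (sym eq))
[,]′-injective f-inj g-inj f≢g {inj₂ b} {inj₂ b′} eq = cong inj₂ (g-inj eq)

copiesOneZero-↑ˡ : {q t : ℕ} (ℓ : ℕ) (a : Fin t) (j : Fin q) → copiesOneZero q t ℓ (a ↑ˡ ℓ) j ≡ true
copiesOneZero-↑ˡ {t = suc t} ℓ zero    j = refl
copiesOneZero-↑ˡ {t = suc t} ℓ (suc a) j = copiesOneZero-↑ˡ {t = t} ℓ a j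

copiesOneZero-↑ʳ : {q ℓ : ℕ} (t : ℕ) (b : Fin ℓ) (j : Fin q) → copiesOneZero q t ℓ (t ↑ʳ b) j ≡ false
copiesOneZero-↑ʳ zero    b j = refl
copiesOneZero-↑ʳ (suc t) b j = copiesOneZero-↑ʳ t b j

column : {m n : ℕ} → Matrix m n → Fin n → Fin m → Bool
column A j i = A i j

copiesOneZero-≺-rows : {t ℓ q m n : ℕ} (A : Matrix m n)
  (σ₁ : Fin t → Fin m) (σ₀ : Fin ℓ → Fin m) (τ : Fin q → Fin n) →
  Injective _≡_ _≡_ σ₁ → Injective _≡_ _≡_ σ₀ → (∀ a b → σ₁ a ≢ σ₀ b) → Injective _≡_ _≡_ τ →
  (∀ a j → A (σ₁ a) (τ j) ≡ true) → (∀ b j → A (σ₀ b) (τ j) ≡ false) → copiesOneZero q t ℓ ≺ A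
copiesOneZero-≺-rows {t} {ℓ} {q} {m} A σ₁ σ₀ τ σ₁-inj σ₀-inj σ₁≢σ₀ τ-inj ones zeros =
  σ , τ , splitAt-injective t ∘ [,]′-injective σ₁-inj σ₀-inj σ₁≢σ₀ , τ-inj , entry
  where
  σ : Fin (t + ℓ) → Fin m
  σ = [ σ₁ , σ₀ ]′ ∘ splitAt t
  entry : ∀ i j → A (σ i) (τ j) ≡ copiesOneZero q t ℓ i j
  entry i j with splitAt t i in e
  ... | inj₁ a = trans (ones a j)
    (trans (sym (copiesOneZero-↑ˡ ℓ a j)) (cong (λ x → copiesOneZero q t ℓ x j) (Fin.splitAt⁻¹-↑ˡ e)))
  ... | inj₂ b = trans (zeros b j)
    (trans (sym (copiesOneZero-↑ʳ t b j)) (cong (λ x → copiesOneZero q t ℓ x j) (Fin.splitAt⁻¹-↑ʳ e)))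

ℓ≤count-∁ : {ℓ q m : ℕ} (U : Fin m → Bool) (P : Fin q → Fin m → Bool) →
  (∀ j → U ⊆ P j) → (∀ j → count (P j) ≡ suc (count U)) →
  count U + ℓ + q ≤ m → ℓ ≤ count (not ∘ (U ∪ ⋃ P))
ℓ≤count-∁ {ℓ} {q} {m} U P U⊆P ∣P∣ bound = +-cancelʳ-≤ (count U + q) ℓ (count Z) (begin
  ℓ + (count U + q)        ≡⟨ trans (sym (+-assoc ℓ (count U) q)) (cong (_+ q) (+-comm ℓ (count U))) ⟩
  count U + ℓ + q          ≤⟨ bound ⟩
  m                        ≡⟨ sym (count-∁ (U ∪ ⋃ P)) ⟩
  count (U ∪ ⋃ P) + count Z ≤⟨ +-monoˡ-≤ (count Z) (count-∪⋃≤ U P U⊆P ∣P∣) ⟩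
  count U + q + count Z    ≡⟨ +-comm (count U + q) (count Z) ⟩
  count Z + (count U + q)  ∎)
  where
  open ≤-Reasoning
  Z : Fin m → Bool
  Z = not ∘ (U ∪ ⋃ P)

copiesOneZero-≺ : {t ℓ q m n : ℕ} (A : Matrix m n) (U : Fin m → Bool) (τ : Fin q → Fin n) →
  count U ≡ t → Injective _≡_ _≡_ τ →
  (∀ j → U ⊆ column A (τ j)) → (∀ j → colSum A (τ j) ≡ suc t) →
  t + ℓ + q ≤ m → copiesOneZero q t ℓ ≺ A
copiesOneZero-≺ {t} {ℓ} A U τ refl τ-inj U⊆τ ∣τ∣ bound
  with select U t ≤-refl
     | select (not ∘ (U ∪ ⋃ (column A ∘ τ))) ℓ (ℓ≤count-∁ U (column A ∘ τ) U⊆τ ∣τ∣ bound)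
... | σ₁ , σ₁-inj , σ₁∈U | σ₀ , σ₀-inj , σ₀∈Z =
  copiesOneZero-≺-rows A σ₁ σ₀ τ σ₁-inj σ₀-inj σ₁≢σ₀ τ-inj
    (λ a j → U⊆τ j (σ₁ a) (σ₁∈U a))
    (λ b j → ⋃-false (column A ∘ τ) (proj₂ (∨-false (σ₀∉W b))) j)
  where
  σ₀∉W : ∀ b → (U ∪ ⋃ (column A ∘ τ)) (σ₀ b) ≡ false
  σ₀∉W b = not-injective (σ₀∈Z b)
  σ₁≢σ₀ : ∀ a b → σ₁ a ≢ σ₀ b
  σ₁≢σ₀ a b eq with trans (sym (σ₁∈U a)) (trans (cong U eq) (proj₁ (∨-false (σ₀∉W b))))
  ... | ()

degree : {n k : ℕ} → (Fin n → Bool) → (Fin n → Fin k → Bool) → (Fin k → Bool) → ℕ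
degree sel V T = count (λ j → sel j ∧ (T ⊆ᵇ V j))

incidences : {n k : ℕ} → (Fin n → Bool) → (Fin n → Fin k → Bool) → ℕ → ℕ
incidences {n} sel V s = ∑[ j < n ] (if sel j then count (V j) C s else 0)

incidences-≤ : {n : ℕ} (k s L : ℕ) (sel : Fin n → Bool) (V : Fin n → Fin k → Bool) →
  (∀ T → count T ≡ s → degree sel V T ≤ L) → incidences sel V s ≤ L * (k C s)
incidences-≤ k zero L sel V deg≤ = begin
  incidences sel V 0          ≡⟨ trans (∑-if sel 1) (*-identityʳ _) ⟩
  count sel                   ≡⟨ count-cong (λ j → sym (trans (cong (sel j ∧_) (∅⊆ᵇ (V j)))
                                                                (∧-identityʳ (sel j)))) ⟩
  degree sel V (λ _ → false)  ≤⟨ deg≤ _ (count-∅ k) ⟩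
  L                           ≡⟨ sym (*-identityʳ L) ⟩
  L * (k C 0)                 ∎
  where open ≤-Reasoning
incidences-≤ {n} zero (suc s) L sel V deg≤ =
  ≤-trans (≤-reflexive (trans (sum-cong-≗ (λ j → if-eta (sel j))) (sum-replicate-zero n))) z≤n
incidences-≤ {n} (suc k) (suc s) L sel V deg≤ = begin
  incidences sel V (suc s)
    ≡⟨ sum-cong-≗ (λ j → pascal (sel j) (V j zero) (count (V′ j))) ⟩
  ∑[ j < n ] ((if sel j then count (V′ j) C suc s else 0) + (if sel j ∧ V j zero then count (V′ j) C s else 0))
    ≡⟨ ∑-distrib-+ {n} _ _ ⟩
  incidences sel V′ (suc s) + incidences (λ j → sel j ∧ V j zero) V′ s
    ≤⟨ +-mono-≤ (incidences-≤ k (suc s) L sel V′ (λ T → deg≤ (false ∷ T)))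
                (incidences-≤ k s L (λ j → sel j ∧ V j zero) V′ deg₀≤) ⟩
  L * (k C suc s) + L * (k C s)
    ≡⟨ sym (*-distribˡ-+ L (k C suc s) (k C s)) ⟩
  L * (k C suc s + k C s)
    ≡⟨ cong (L *_) (trans (+-comm (k C suc s) (k C s)) (nCk+nC[k+1]≡[n+1]C[k+1] k s)) ⟩
  L * (suc k C suc s) ∎
  where
  open ≤-Reasoning
  V′ : Fin n → Fin k → Bool
  V′ j = V j ∘ suc
  pascal : ∀ b v c → (if b then ((if v then 1 else 0) + c) C suc s else 0)
                   ≡ (if b then c C suc s else 0) + (if b ∧ v then c C s else 0)
  pascal false v     c = refl
  pascal true  false c = sym (+-identityʳ _)
  pascal true  true  c = trans (sym (nCk+nC[k+1]≡[n+1]C[k+1] c s)) (+-comm (c C s) (c C suc s))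
  deg₀≤ : ∀ T → count T ≡ s → degree (λ j → sel j ∧ V j zero) V′ T ≤ L
  deg₀≤ T ∣T∣ = subst (_≤ L) (count-cong (λ j → sym (∧-assoc (sel j) (V j zero) _)))
                      (deg≤ (true ∷ T) (cong suc ∣T∣))

≡ᵇ-sound : {a b : ℕ} → (a ≡ᵇ b) ≡ true → a ≡ b
≡ᵇ-sound {zero}  {zero}  _ = refl
≡ᵇ-sound {suc a} {suc b} h = cong suc (≡ᵇ-sound h)

columns⊇-< : {t ℓ q m n : ℕ} (A : Matrix m n) → ¬ (copiesOneZero q t ℓ ≺ A) → t + ℓ + q ≤ m →
  (U : Fin m → Bool) → count U ≡ t → count (λ j → (colSum A j ≡ᵇ suc t) ∧ (U ⊆ᵇ column A j)) < q
columns⊇-< {t} {ℓ} {q} A noF bound U ∣U∣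
  with q ≤? count (λ j → (colSum A j ≡ᵇ suc t) ∧ (U ⊆ᵇ column A j))
... | no  q≰ = ≰⇒> q≰
... | yes q≤ with select _ q q≤
...   | τ , τ-inj , τ⊇U = ⊥-elim (noF (copiesOneZero-≺ A U τ ∣U∣ τ-inj
          (λ j → ⊆ᵇ⇒⊆ (proj₂ (∧-true (τ⊇U j))))
          (λ j → ≡ᵇ-sound (proj₁ (∧-true (τ⊇U j)))) bound))

insertAt-⊆ᵇ : {k : ℕ} (T : Fin k → Bool) (r : Fin (suc k)) (v : Fin (suc k) → Bool) →
  (insertAt T r true ⊆ᵇ v) ≡ v r ∧ (T ⊆ᵇ (v ∘ punchIn r))
insertAt-⊆ᵇ         T zero    v = refl
insertAt-⊆ᵇ {suc k} T (suc r) v = begin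
  x ∧ (insertAt (T ∘ suc) r true ⊆ᵇ (v ∘ suc))    ≡⟨ cong (x ∧_) (insertAt-⊆ᵇ (T ∘ suc) r (v ∘ suc)) ⟩
  x ∧ (v (suc r) ∧ y)                             ≡⟨ sym (∧-assoc x (v (suc r)) y) ⟩
  (x ∧ v (suc r)) ∧ y                             ≡⟨ cong (_∧ y) (∧-comm x (v (suc r))) ⟩
  (v (suc r) ∧ x) ∧ y                             ≡⟨ ∧-assoc (v (suc r)) x y ⟩
  v (suc r) ∧ (x ∧ y)                             ∎
  where
  open ≡-Reasoning
  x y : Bool
  x = not (T zero) ∨ v zero
  y = (T ∘ suc) ⊆ᵇ (v ∘ suc ∘ punchIn r)

count-insertAt : {k : ℕ} (T : Fin k → Bool) (r : Fin (suc k)) → count (insertAt T r true) ≡ suc (count T)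
count-insertAt T r =
  trans (count-punchIn (insertAt T r true) r (insertAt-lookup T r true)) (cong suc (count-cong (insertAt-punchIn T r true)))

throughRow : {m n : ℕ} → Matrix m n → ℕ → Fin m → Fin n → Bool
throughRow A s r j = (colSum A j ≡ᵇ s) ∧ A r j

deleteRow : {m n : ℕ} → Matrix (suc m) n → Fin (suc m) → Fin n → Fin m → Bool
deleteRow A r j = column A j ∘ punchIn r

colsWithSumAndRow≡count : {m n : ℕ} (A : Matrix m n) (s : ℕ) (r : Fin m) →
  colsWithSumAndRow A s r ≡ count (throughRow A s r)
colsWithSumAndRow≡count A s r = count-cong λ j → if-false (colSum A j ≡ᵇ s)
  where
  if-false : ∀ b {x} → (if b then x else false) ≡ b ∧ x
  if-false true  = refl
  if-false false = refl

[1+n]Cn≡1+n : ∀ n → suc n C n ≡ suc n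
[1+n]Cn≡1+n n = trans (nCk≡nC[n∸k] (n≤1+n n)) (trans (cong (suc n C_) (m+n∸n≡m 1 n)) (nC1≡n (suc n)))

count-throughRow≡incidences : {m n : ℕ} (t : ℕ) (A : Matrix (suc m) n) (r : Fin (suc m)) →
  count (throughRow A (suc (suc t)) r) * suc t ≡ incidences (throughRow A (suc (suc t)) r) (deleteRow A r) t
count-throughRow≡incidences {n = n} t A r =
  trans (sym (∑-if (throughRow A (suc (suc t)) r) (suc t))) (sum-cong-≗ pointwise)
  where
  pointwise : ∀ j → (if throughRow A (suc (suc t)) r j then suc t else 0)
                  ≡ (if throughRow A (suc (suc t)) r j then count (deleteRow A r j) C t else 0)
  pointwise j with throughRow A (suc (suc t)) r j in e
  ... | false = refl
  ... | true with ∧-true {colSum A j ≡ᵇ suc (suc t)} e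
  ...   | sum≡ , Arj = sym (trans (cong (_C t) ∣deleteRow∣) ([1+n]Cn≡1+n t))
    where
    ∣deleteRow∣ : count (deleteRow A r j) ≡ suc t
    ∣deleteRow∣ = suc-injective (trans (sym (count-punchIn (column A j) r Arj)) (≡ᵇ-sound sum≡))

degree-throughRow-< : {t ℓ q m n : ℕ} (A : Matrix (suc m) n) → ¬ (copiesOneZero q (suc t) ℓ ≺ A) →
  suc t + ℓ + q ≤ suc m → (r : Fin (suc m)) (T : Fin m → Bool) → count T ≡ t →
  degree (throughRow A (suc (suc t)) r) (deleteRow A r) T < q
degree-throughRow-< {t} A noF bound r T ∣T∣ =
  subst (_< _) (count-cong reassociate)
    (columns⊇-< A noF bound (insertAt T r true) (trans (count-insertAt T r) (cong suc ∣T∣)))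
  where
  reassociate : ∀ j → (colSum A j ≡ᵇ suc (suc t)) ∧ (insertAt T r true ⊆ᵇ column A j)
                    ≡ throughRow A (suc (suc t)) r j ∧ (T ⊆ᵇ deleteRow A r j)
  reassociate j = trans (cong ((colSum A j ≡ᵇ suc (suc t)) ∧_) (insertAt-⊆ᵇ T r (column A j)))
                        (sym (∧-assoc (colSum A j ≡ᵇ suc (suc t)) (A r j) _))

lemma5 : (t ℓ λ' m n : ℕ) → ℓ < t → 1 ≤ λ' → t + ℓ + λ' + 2 < m →
    (A : Matrix m n) →
    ¬ (copiesOneZero (λ' + 2) t ℓ ≺ A) →
    (∀ j → t ≤ colSum A j × colSum A j ≤ m ∸ ℓ) →
    (∀ j j' → colSum A j ≡ t → colSum A j' ≡ t → (∀ i → A i j ≡ A i j') → j ≡ j') →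
    (r : Fin m) →
    colsWithSumAndRow A (suc t) r * t ≤ (λ' + 1) * ((m ∸ 1) C (t ∸ 1))
lemma5 zero    ℓ λ' m       n () _ _ _ _ _ _ _
lemma5 (suc t) ℓ λ' zero    n _ _ _ _ _ _ _ ()
lemma5 (suc t) ℓ λ' (suc m) n _ _ bound A noF _ _ r = begin
  colsWithSumAndRow A (suc (suc t)) r * suc t  ≡⟨ cong (_* suc t) (colsWithSumAndRow≡count A _ r) ⟩
  count sel * suc t                            ≡⟨ count-throughRow≡incidences t A r ⟩
  incidences sel (deleteRow A r) t             ≤⟨ incidences-≤ m t (λ' + 1) sel (deleteRow A r) degree≤ ⟩
  (λ' + 1) * (m C t)                           ∎
  where
  open ≤-Reasoning
  sel : Fin n → Bool
  sel = throughRow A (suc (suc t)) r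
  degree≤ : ∀ T → count T ≡ t → degree sel (deleteRow A r) T ≤ λ' + 1
  degree≤ T ∣T∣ = s≤s⁻¹ (subst (degree sel (deleteRow A r) T <_) (+-suc λ' 1)
    (degree-throughRow-< A noF (subst (_≤ suc m) (+-assoc (suc t + ℓ) λ' 2) (<⇒≤ bound)) r T ∣T∣))
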